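{- Consider the deadline-monotonic partitioning algorithm with the best-fit strategy (as described in the context), whose schedulability test for assigning a task to a processor is the pair of conditions (A) and (B) below. Its approximation factor for the multiprocessor partitioned packing problem is at least $N/4$ when $N\ge 8$, where $N$ is the number of tasks; that is, for $N\ge 8$ there are task sets with $N$ tasks on which the number of processors it allocates is at least $\frac{N}{4}M^*$, where $M^*$ is the minimum number of processors in a feasible task partition.
   Context: A sporadic task $\tau_i=(C_i,T_i,D_i)$ has worst-case execution time $C_i>0$, period $T_i>0$, relative deadline $D_i>0$, utilization $u_i=C_i/T_i$, and demand bound function $\mathrm{dbf}(\tau_i,t)=\max\{0,\lfloor (t-D_i)/T_i\rfloor+1\}C_i$. A task set is feasibly scheduled by EDF on one processor iff $\sum_i\mathrm{dbf}(\tau_i,t)\le t$ for all $t\ge0$. A feasible task partition on $M$ processors is a partition of the task set into $M$ disjoint subsets each feasibly scheduled by EDF on one processor; the multiprocessor partitioned packing problem asks to minimize $M$ (optimum $M^*$). Assume $C_i/T_i\le1$ and $C_i/D_i\le1$ for all tasks. Approximate demand bound function: $\mathrm{dbf}^*(\tau_i,t)=0$ if $t<D_i$ and $\mathrm{dbf}^*(\tau_i,t)=\left(\frac{t-D_i}{T_i}+1\right)C_i$ otherwise. Deadline-monotonic (DM) partitioning: index tasks so that $D_i\le D_j$ for $i<j$; put $\tau_1$ on processor 1 (so $M=1$). For $i=2,\dots,N$: call an already allocated processor $m$ (with current assigned set $\mathbf{T}_m\subseteq\{\tau_1,\dots,\tau_{i-1}\}$) admissible if both (A) $C_i+\sum_{\tau_j\in\mathbf{T}_m}\mathrm{dbf}^*(\tau_j,D_i)\le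 D_i$ and (B) $u_i+\sum_{\tau_j\in\mathbf{T}_m}u_j\le 1$ hold. If some processor is admissible, assign $\tau_i$ to an admissible processor chosen by the fitting strategy; otherwise allocate a new processor $M\leftarrow M+1$ and assign $\tau_i$ to it. The best-fit strategy chooses, among the admissible processors, one with the maximum approximate demand bound $\sum_{\tau_j\in\mathbf{T}_m}\mathrm{dbf}^*(\tau_j,D_i)$ at time $D_i$. -}

module Defs where

open import Data.Nat as ℕ using (ℕ; suc)
import Data.Integer as ℤ
open import Data.Rational using (ℚ; 0ℚ; 1ℚ; _+_; _-_; _*_; _÷_; _≤_; _<_; _/_; floor; Positive)
open import Data.Rational.Properties using (_<?_; pos⇒nonZero)
open import Data.List using (List; []; _∷_; map; concat; foldr)
open import Data.List.Relation.Binary.Permutation.Propositional using (_↭_)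
open import Data.List.Relation.Unary.Linked using (Linked)
open import Data.Vec as Vec using (Vec; lookup; updateAt; _∷ʳ_; toList)
open import Data.Fin using (Fin)
open import Data.Product using (Σ; _×_; ∃-syntax)
open import Data.Bool using (if_then_else_)
open import Relation.Nullary using (¬_; does)

sumℚ : List ℚ → ℚ
sumℚ = foldr _+_ 0ℚ

record Task : Set where
  constructor task
  field
    C T D : ℚ
    C-pos : Positive C
    T-pos : Positive T
    D-pos : Positive D
open Task public

-- standing assumptions C/T ≤ 1 and C/D ≤ 1 (equivalently C ≤ T, C ≤ D since T, D > 0)
Assumptions : Task → Set
Assumptions τ = (C τ ≤ T τ) × (C τ ≤ D τ)

_div-T_ : ℚ → Task → ℚ
x div-T τ = _÷_ x (T τ) {{pos⇒nonZero (T τ) {{T-pos τ}}}}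

u : Task → ℚ
u τ = C τ div-T τ

dbf : Task → ℚ → ℚ
dbf τ t = ((ℤ.0ℤ ℤ.⊔ (floor ((t - D τ) div-T τ) ℤ.+ ℤ.1ℤ)) / 1) * C τ

dbf* : Task → ℚ → ℚ
dbf* τ t = if does (t <? D τ) then 0ℚ else (((t - D τ) div-T τ) + 1ℚ) * C τ

EDFFeasible : List Task → Set
EDFFeasible ts = ∀ (t : ℚ) → 0ℚ ≤ t → sumℚ (map (λ τ → dbf τ t) ts) ≤ t

FeasiblePartition : List Task → ℕ → Set
FeasiblePartition ts m =
  Σ (Vec (List Task) m) λ Ps → (concat (toList Ps) ↭ ts) × (∀ p → EDFFeasible (lookup Ps p))

IsOptimalProcessors : List Task → ℕ → Set
IsOptimalProcessors ts m* = FeasiblePartition ts m* × (∀ m → FeasiblePartition ts m → m* ℕ.≤ m)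

DMSorted : List Task → Set
DMSorted = Linked (λ a b → D a ≤ D b)

sumDbf* : List Task → ℚ → ℚ
sumDbf* ts t = sumℚ (map (λ τ → dbf* τ t) ts)

sumU : List Task → ℚ
sumU ts = sumℚ (map u ts)

-- schedulability test (A) and (B)
Admissible : Task → List Task → Set
Admissible τ P = (C τ + sumDbf* P (D τ) ≤ D τ) × (u τ + sumU P ≤ 1ℚ)

-- one step of DM partitioning with best fit (any tie-breaking among maximal processors)
data BestFitStep {m : ℕ} (Ps : Vec (List Task) m) (τ : Task) : (m' : ℕ) → Vec (List Task) m' → Set where
  assign : (k : Fin m) → Admissible τ (lookup Ps k) →
           (∀ j → Admissible τ (lookup Ps j) → sumDbf* (lookup Ps j) (D τ) ≤ sumDbf* (lookup Ps k) (D τ)) →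
           BestFitStep Ps τ m (updateAt Ps k (τ ∷_))
  open-new : (∀ j → ¬ Admissible τ (lookup Ps j)) →
             BestFitStep Ps τ (suc m) (Ps ∷ʳ (τ ∷ []))

data BestFitRun : {m : ℕ} → Vec (List Task) m → List Task → (m' : ℕ) → Vec (List Task) m' → Set where
  done : ∀ {m} {Ps : Vec (List Task) m} → BestFitRun Ps [] m Ps
  step : ∀ {m m' m''} {Ps : Vec (List Task) m} {τ ts} {Ps' : Vec (List Task) m'} {Qs : Vec (List Task) m''} →
         BestFitStep Ps τ m' Ps' → BestFitRun Ps' ts m'' Qs → BestFitRun Ps (τ ∷ ts) m'' Qs

-- DMBestFit ts M : on the (already DM-indexed) task list ts, the algorithm can end with M processors
data DMBestFit : List Task → ℕ → Set where
  empty : DMBestFit [] 0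
  run   : ∀ {τ ts M} {Qs : Vec (List Task) M} →
          BestFitRun ((τ ∷ []) Vec.∷ Vec.[]) ts M Qs → DMBestFit (τ ∷ ts) M

module Submission where

open import Data.Bool using (if_then_else_)
open import Data.Empty using (⊥-elim)
open import Data.Fin as Fin using (Fin; inject₁; toℕ)
import Data.Fin.Properties as Finₚ
open import Data.Integer as ℤ using (ℤ; 0ℤ; 1ℤ)
import Data.Integer.DivMod as ℤ
import Data.Integer.Properties as ℤ
open import Data.List using (List; []; _∷_; _++_; map; length; applyUpTo; applyDownFrom)
import Data.List.Properties as List
open import Data.List.Membership.Propositional using (_∈_)
open import Data.List.Relation.Binary.Permutation.Propositional using (_↭_; prep; swap; ↭-sym; ↭-trans)
import Data.List.Relation.Binary.Permutation.Propositional as Perm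
open import Data.List.Relation.Binary.Permutation.Propositional.Properties
  using (map⁺; shift; drop-∷; ∈-resp-↭; ↭-length; ↭-reverse; ↭-empty-inv; ++-identityʳ)
open import Data.List.Relation.Unary.All as All using (All; []; _∷_)
open import Data.List.Relation.Unary.All.Properties using (applyUpTo⁺₂)
import Data.List.Relation.Unary.AllPairs as AllPairs
open import Data.List.Relation.Unary.Any using (here; there)
open import Data.List.Relation.Unary.Linked as Linked using (Linked; [-])
open import Data.List.Relation.Unary.Linked.Properties using (Linked⇒AllPairs)
open import Data.Nat as ℕ using (ℕ; zero; suc; _∸_; ⌊_/2⌋; ⌈_/2⌉)
import Data.Nat.Properties as ℕ
open import Data.Product using (Σ; _,_; _×_; ∃-syntax)
open import Data.Rational
open import Data.Rational.Literals using (fromℤ)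
open import Data.Rational.Properties
open import Data.Rational.Solver using (module +-*-Solver)
open import Data.Sum using (_⊎_; inj₁; inj₂; [_,_]′)
open import Data.Vec as Vec using (Vec; lookup; updateAt; _∷ʳ_)
open import Function using (_∘_)
open import Relation.Binary.PropositionalEquality
open import Relation.Nullary using (yes; no; ¬_; contradiction)
open import Relation.Nullary.Decidable using (dec-true; dec-false)
open import Defs
open +-*-Solver

-- The instance interleaves tasks a₀, b₀, a₁, b₁, … whose deadlines R^(k+1) < 2R^(k+1) grow
-- geometrically with ratio R = 4N. Each aₖ has execution time (R − 2)Rᵏ, close to its deadline,
-- but utilization only 1/(NR); each bₖ has implicit deadline 2R^(k+1) and utilization 1/N.
-- All a-tasks fit on one processor, because at any time the latest active one dominates their
-- geometric total demand, and all b-tasks fit on another, because their utilizations sum to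
-- at most 1; b₀ and a₁ together overload a single processor at time R², so M* = 2.
-- Best fit, on the other hand, finds aᵢ inadmissible by (A) on every processor {bⱼ, aⱼ}
-- (j < i), since bⱼ alone demands 4Rⁱ by the deadline Rⁱ⁺¹ of aᵢ, and then places bᵢ next to
-- aᵢ, whose approximate demand at the deadline of bᵢ exceeds that of every older pair.
-- It therefore opens ⌈N/2⌉ processors.

≤-by : ∀ {x y} z → y ≡ x + z → 0ℚ ≤ z → x ≤ y
≤-by {x} z refl 0≤z = subst (_≤ x + z) (+-identityʳ x) (+-monoʳ-≤ x 0≤z)

<-by : ∀ {x y} z → y ≡ x + z → 0ℚ < z → x < y
<-by {x} z refl 0<z = subst (_< x + z) (+-identityʳ x) (+-monoʳ-< x 0<z)

≤⇒≯ : ∀ {p q} → p ≤ q → ¬ q < p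
≤⇒≯ p≤q q<p = <-irrefl refl (<-≤-trans q<p p≤q)

<∨≥ : ∀ x y → x < y ⊎ y ≤ x
<∨≥ x y with x <? y
... | yes x<y = inj₁ x<y
... | no x≮y = inj₂ (≮⇒≥ x≮y)

p≤q⇒0≤q-p : ∀ {p q} → p ≤ q → 0ℚ ≤ q - p
p≤q⇒0≤q-p {p} {q} p≤q = subst (_≤ q - p) (+-inverseʳ p) (+-monoˡ-≤ (- p) p≤q)

p<q⇒p-q<0 : ∀ {p q} → p < q → p - q < 0ℚ
p<q⇒p-q<0 {p} {q} p<q = subst (p - q <_) (+-inverseʳ q) (+-monoˡ-< (- q) p<q)

*-nonNeg : ∀ {p q} → 0ℚ ≤ p → 0ℚ ≤ q → 0ℚ ≤ p * q
*-nonNeg {p} {q} 0≤p 0≤q = subst (_≤ p * q) (*-zeroʳ p) (*-monoˡ-≤-nonNeg p {{nonNegative 0≤p}} 0≤q)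

*-pos : ∀ {p q} → 0ℚ < p → 0ℚ < q → 0ℚ < p * q
*-pos {p} {q} 0<p 0<q = subst (_< p * q) (*-zeroʳ p) (*-monoʳ-<-pos p {{positive 0<p}} 0<q)

fromℤ-mono-≤ : ∀ {i j} → i ℤ.≤ j → fromℤ i ≤ fromℤ j
fromℤ-mono-≤ {i} {j} i≤j = *≤* (subst₂ ℤ._≤_ (sym (ℤ.*-identityʳ i)) (sym (ℤ.*-identityʳ j)) i≤j)

fromℤ-cancel-< : ∀ {i j} → fromℤ i < fromℤ j → i ℤ.< j
fromℤ-cancel-< {i} {j} (*<* i<j) = subst₂ ℤ._<_ (ℤ.*-identityʳ i) (ℤ.*-identityʳ j) i<j

z/1≡fromℤ : ∀ z → z / 1 ≡ fromℤ z
z/1≡fromℤ z = ↥p/↧p≡p (fromℤ z)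

fromℤ-+1 : ∀ z → fromℤ (z ℤ.+ 1ℤ) ≡ fromℤ z + 1ℚ
fromℤ-+1 z = sym (trans (cong (λ w → (w ℤ.+ 1ℤ) / 1) (ℤ.*-identityʳ z)) (z/1≡fromℤ (z ℤ.+ 1ℤ)))

fromℕ : ℕ → ℚ
fromℕ k = fromℤ (ℤ.+ k)

fromℕ-mono-≤ : ∀ {j k} → j ℕ.≤ k → fromℕ j ≤ fromℕ k
fromℕ-mono-≤ j≤k = fromℤ-mono-≤ (ℤ.+≤+ j≤k)

fromℕ-suc : ∀ c → fromℕ (suc c) ≡ fromℕ c + 1ℚ
fromℕ-suc c = trans (cong fromℕ (ℕ.+-comm 1 c)) (fromℤ-+1 (ℤ.+ c))

fromℤ-floor≤ : ∀ x → fromℤ (floor x) ≤ x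
fromℤ-floor≤ (mkℚ n d-1 _) =
  *≤* (subst (ℤ._≤_ _) (sym (ℤ.*-identityʳ n)) (ℤ.[n/d]*d≤n n (ℤ.+ suc d-1)))

<fromℤ-floor+1 : ∀ x → x < fromℤ (floor x ℤ.+ 1ℤ)
<fromℤ-floor+1 (mkℚ n d-1 _) = *<* (subst₂ ℤ._<_ (sym (ℤ.*-identityʳ n)) d+qd≡[q+1]d n<d+qd)
  where
  d : ℤ
  d = ℤ.+ suc d-1
  q : ℤ
  q = n ℤ./ d
  n<d+qd : n ℤ.< d ℤ.+ q ℤ.* d
  n<d+qd = subst (ℤ._< d ℤ.+ q ℤ.* d) (sym (ℤ.a≡a%n+[a/n]*n n d))
             (ℤ.+-monoˡ-< (q ℤ.* d) (ℤ.+<+ (ℤ.n%d<d n d)))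
  d+qd≡[q+1]d : d ℤ.+ q ℤ.* d ≡ (q ℤ.+ 1ℤ) ℤ.* d
  d+qd≡[q+1]d = trans (sym (ℤ.suc-* q d)) (cong (ℤ._* d) (ℤ.+-comm 1ℤ q))

-- Demand bound functions

jobCount : ℚ → ℚ
jobCount x = (0ℤ ℤ.⊔ (floor x ℤ.+ 1ℤ)) / 1

jobCount-neg : ∀ {x} → x < 0ℚ → jobCount x ≡ 0ℚ
jobCount-neg {x} x<0 = cong (_/ 1) (ℤ.i≥j⇒i⊔j≡i ⌊x⌋+1≤0)
  where
  ⌊x⌋+1≤0 : floor x ℤ.+ 1ℤ ℤ.≤ 0ℤ
  ⌊x⌋+1≤0 = subst (ℤ._≤ 0ℤ) (ℤ.+-comm 1ℤ (floor x))
              (ℤ.i<j⇒suc[i]≤j (fromℤ-cancel-< (≤-<-trans (fromℤ-floor≤ x) x<0)))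

jobCount-nonNeg : ∀ {x} → 0ℚ ≤ x → jobCount x ≡ fromℤ (floor x ℤ.+ 1ℤ)
jobCount-nonNeg {x} 0≤x =
  trans (cong (_/ 1) (ℤ.i≤j⇒i⊔j≡j (ℤ.<⇒≤ 0<⌊x⌋+1))) (z/1≡fromℤ (floor x ℤ.+ 1ℤ))
  where
  0<⌊x⌋+1 : 0ℤ ℤ.< floor x ℤ.+ 1ℤ
  0<⌊x⌋+1 = fromℤ-cancel-< (≤-<-trans 0≤x (<fromℤ-floor+1 x))

jobCount-≥ : ∀ {x} → 0ℚ ≤ x → x ≤ jobCount x
jobCount-≥ {x} 0≤x = subst (x ≤_) (sym (jobCount-nonNeg 0≤x)) (<⇒≤ (<fromℤ-floor+1 x))

1≤jobCount : ∀ {x} → 0ℚ ≤ x → 1ℚ ≤ jobCount x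
1≤jobCount {x} 0≤x = subst (1ℚ ≤_) (sym (jobCount-nonNeg 0≤x))
  (fromℤ-mono-≤ (ℤ.i<j⇒suc[i]≤j (fromℤ-cancel-< (≤-<-trans 0≤x (<fromℤ-floor+1 x)))))

jobCount-≤ : ∀ {x} → 0ℚ ≤ x → jobCount x ≤ x + 1ℚ
jobCount-≤ {x} 0≤x = subst (_≤ x + 1ℚ) (sym (trans (jobCount-nonNeg 0≤x) (fromℤ-+1 (floor x))))
  (+-monoˡ-≤ 1ℚ (fromℤ-floor≤ x))

1/T : Task → ℚ
1/T τ = (1/ T τ) {{pos⇒nonZero (T τ) {{T-pos τ}}}}

0<1/T : ∀ τ → 0ℚ < 1/T τ
0<1/T τ = positive⁻¹ (1/T τ) {{1/pos⇒pos (T τ) {{T-pos τ}}}}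

T*1/T≡1 : ∀ τ → T τ * 1/T τ ≡ 1ℚ
T*1/T≡1 τ = *-inverseʳ (T τ) {{pos⇒nonZero (T τ) {{T-pos τ}}}}

0<C : ∀ τ → 0ℚ < C τ
0<C τ = positive⁻¹ (C τ) {{C-pos τ}}

0<D : ∀ τ → 0ℚ < D τ
0<D τ = positive⁻¹ (D τ) {{D-pos τ}}

u*T≡C : ∀ τ → u τ * T τ ≡ C τ
u*T≡C τ = trans (solve 3 (λ c t w → c :* w :* t := c :* (t :* w)) refl (C τ) (T τ) (1/T τ))
                (trans (cong (C τ *_) (T*1/T≡1 τ)) (*-identityʳ (C τ)))

0≤u : ∀ τ → 0ℚ ≤ u τ
0≤u τ = *-nonNeg (<⇒≤ (0<C τ)) (<⇒≤ (0<1/T τ))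

dbf*-below : ∀ τ {t} → t < D τ → dbf* τ t ≡ 0ℚ
dbf*-below τ {t} t<D =
  cong (λ b → if b then 0ℚ else ((t - D τ) div-T τ + 1ℚ) * C τ) (dec-true (t <? D τ) t<D)

dbf*-above : ∀ τ {t} → D τ ≤ t → dbf* τ t ≡ ((t - D τ) div-T τ + 1ℚ) * C τ
dbf*-above τ {t} D≤t =
  cong (λ b → if b then 0ℚ else ((t - D τ) div-T τ + 1ℚ) * C τ) (dec-false (t <? D τ) (≤⇒≯ D≤t))

dbf*-above-u : ∀ τ {t} → D τ ≤ t → dbf* τ t ≡ C τ + (t - D τ) * u τ
dbf*-above-u τ {t} D≤t = trans (dbf*-above τ D≤t)
  (solve 3 (λ x w c → (x :* w :+ con 1ℚ) :* c := c :+ x :* (c :* w)) refl (t - D τ) (1/T τ) (C τ))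

0≤dbf* : ∀ τ t → 0ℚ ≤ dbf* τ t
0≤dbf* τ t with t <? D τ
... | yes t<D = ≤-reflexive (sym (dbf*-below τ t<D))
... | no t≮D = subst (0ℚ ≤_) (sym (dbf*-above-u τ (≮⇒≥ t≮D)))
                 (+-mono-≤ (<⇒≤ (0<C τ)) (*-nonNeg (p≤q⇒0≤q-p (≮⇒≥ t≮D)) (0≤u τ)))

dbf*≤C+t*u : ∀ τ {t} → 0ℚ ≤ t → dbf* τ t ≤ C τ + t * u τ
dbf*≤C+t*u τ {t} 0≤t with t <? D τ
... | yes t<D = subst (_≤ C τ + t * u τ) (sym (dbf*-below τ t<D))
                  (+-mono-≤ (<⇒≤ (0<C τ)) (*-nonNeg 0≤t (0≤u τ)))
... | no t≮D = ≤-by (D τ * u τ)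
  (trans (solve 4 (λ c t d u → c :+ t :* u := c :+ (t :- d) :* u :+ d :* u) refl (C τ) t (D τ) (u τ))
         (cong (_+ D τ * u τ) (sym (dbf*-above-u τ (≮⇒≥ t≮D)))))
  (*-nonNeg (<⇒≤ (0<D τ)) (0≤u τ))

dbf*-implicitDeadline : ∀ τ {t} → T τ ≡ D τ → D τ ≤ t → dbf* τ t ≡ u τ * t
dbf*-implicitDeadline τ {t} T≡D D≤t = begin
  dbf* τ t                       ≡⟨ dbf*-above-u τ D≤t ⟩
  C τ + (t - D τ) * u τ          ≡⟨ cong (λ c → c + (t - D τ) * u τ) (sym (u*T≡C τ)) ⟩
  u τ * T τ + (t - D τ) * u τ    ≡⟨ cong (λ d → u τ * d + (t - D τ) * u τ) T≡D ⟩
  u τ * D τ + (t - D τ) * u τ    ≡⟨ solve 3 (λ u d t → u :* d :+ (t :- d) :* u := u :* t) refl (u τ) (D τ) t ⟩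
  u τ * t                        ∎
  where open ≡-Reasoning

dbf*≤u*t : ∀ τ {t} → T τ ≡ D τ → 0ℚ ≤ t → dbf* τ t ≤ u τ * t
dbf*≤u*t τ {t} T≡D 0≤t with t <? D τ
... | yes t<D = subst (_≤ u τ * t) (sym (dbf*-below τ t<D)) (*-nonNeg (0≤u τ) 0≤t)
... | no t≮D = ≤-reflexive (dbf*-implicitDeadline τ T≡D (≮⇒≥ t≮D))

dbf-below : ∀ τ {t} → t < D τ → dbf τ t ≡ 0ℚ
dbf-below τ {t} t<D = trans (cong (_* C τ) (jobCount-neg x<0)) (*-zeroˡ (C τ))
  where
  x<0 : (t - D τ) div-T τ < 0ℚ
  x<0 = subst ((t - D τ) div-T τ <_) (*-zeroˡ (1/T τ))
          (*-monoˡ-<-pos (1/T τ) {{positive (0<1/T τ)}} (p<q⇒p-q<0 t<D))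

div-T-nonNeg : ∀ τ {t} → D τ ≤ t → 0ℚ ≤ (t - D τ) div-T τ
div-T-nonNeg τ D≤t = *-nonNeg (p≤q⇒0≤q-p D≤t) (<⇒≤ (0<1/T τ))

≤jobCount⇒≤dbf : ∀ τ t {x} → x ≤ jobCount ((t - D τ) div-T τ) → x * C τ ≤ dbf τ t
≤jobCount⇒≤dbf τ t = *-monoʳ-≤-nonNeg (C τ) {{nonNegative (<⇒≤ (0<C τ))}}

C≤dbf : ∀ τ {t} → D τ ≤ t → C τ ≤ dbf τ t
C≤dbf τ {t} D≤t =
  subst (_≤ dbf τ t) (*-identityˡ (C τ)) (≤jobCount⇒≤dbf τ t (1≤jobCount (div-T-nonNeg τ D≤t)))

[t-D]*u≤dbf : ∀ τ {t} → D τ ≤ t → (t - D τ) * u τ ≤ dbf τ t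
[t-D]*u≤dbf τ {t} D≤t = subst (_≤ dbf τ t)
  (solve 3 (λ x w c → x :* w :* c := x :* (c :* w)) refl (t - D τ) (1/T τ) (C τ))
  (≤jobCount⇒≤dbf τ t (jobCount-≥ (div-T-nonNeg τ D≤t)))

dbf≤dbf* : ∀ τ t → dbf τ t ≤ dbf* τ t
dbf≤dbf* τ t with t <? D τ
... | yes t<D = ≤-reflexive (trans (dbf-below τ t<D) (sym (dbf*-below τ t<D)))
... | no t≮D = subst (dbf τ t ≤_) (sym (dbf*-above τ (≮⇒≥ t≮D)))
                 (*-monoʳ-≤-nonNeg (C τ) {{nonNegative (<⇒≤ (0<C τ))}} (jobCount-≤ (div-T-nonNeg τ (≮⇒≥ t≮D))))

0≤dbf : ∀ τ t → 0ℚ ≤ dbf τ t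
0≤dbf τ t with t <? D τ
... | yes t<D = ≤-reflexive (sym (dbf-below τ t<D))
... | no t≮D = ≤-trans (<⇒≤ (0<C τ)) (C≤dbf τ (≮⇒≥ t≮D))

-- EDF feasibility

sumℚ-↭ : ∀ {xs ys} → xs ↭ ys → sumℚ xs ≡ sumℚ ys
sumℚ-↭ Perm.refl = refl
sumℚ-↭ (prep x p) = cong (x +_) (sumℚ-↭ p)
sumℚ-↭ {x ∷ y ∷ xs} (swap _ _ p) = trans (cong (λ s → x + (y + s)) (sumℚ-↭ p))
  (solve 3 (λ x y s → x :+ (y :+ s) := y :+ (x :+ s)) refl x y _)
sumℚ-↭ (Perm.trans p q) = trans (sumℚ-↭ p) (sumℚ-↭ q)

sumℚ-map-mono : ∀ {A : Set} {f g : A → ℚ} → (∀ x → f x ≤ g x) → ∀ xs → sumℚ (map f xs) ≤ sumℚ (map g xs)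
sumℚ-map-mono f≤g [] = ≤-refl
sumℚ-map-mono f≤g (x ∷ xs) = +-mono-≤ (f≤g x) (sumℚ-map-mono f≤g xs)

sumℚ-map-nonNeg : ∀ {A : Set} {f : A → ℚ} → (∀ x → 0ℚ ≤ f x) → ∀ xs → 0ℚ ≤ sumℚ (map f xs)
sumℚ-map-nonNeg 0≤f [] = ≤-refl
sumℚ-map-nonNeg 0≤f (x ∷ xs) = +-mono-≤ (0≤f x) (sumℚ-map-nonNeg 0≤f xs)

sumU-applyUpTo : ∀ {f : ℕ → Task} {x} → (∀ k → u (f k) ≡ x) → ∀ c → sumU (applyUpTo f c) ≡ fromℕ c * x
sumU-applyUpTo {x = x} u≡x zero = sym (*-zeroˡ x)
sumU-applyUpTo {f} {x} u≡x (suc c) = begin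
  u (f 0) + sumU (applyUpTo (f ∘ suc) c)  ≡⟨ cong₂ _+_ (u≡x 0) (sumU-applyUpTo (u≡x ∘ suc) c) ⟩
  x + fromℕ c * x                    ≡⟨ solve 2 (λ x c → x :+ c :* x := (c :+ con 1ℚ) :* x) refl x (fromℕ c) ⟩
  (fromℕ c + 1ℚ) * x                 ≡⟨ cong (_* x) (sym (fromℕ-suc c)) ⟩
  fromℕ (suc c) * x                    ∎
  where open ≡-Reasoning

EDFFeasible-[] : EDFFeasible []
EDFFeasible-[] t 0≤t = 0≤t

EDFFeasible-resp-↭ : ∀ {xs ys} → xs ↭ ys → EDFFeasible xs → EDFFeasible ys
EDFFeasible-resp-↭ xs↭ys feasible t 0≤t = subst (_≤ t) (sumℚ-↭ (map⁺ (λ τ → dbf τ t) xs↭ys)) (feasible t 0≤t)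

sumDbf*≤t⇒EDFFeasible : ∀ {ts} → (∀ t → 0ℚ ≤ t → sumDbf* ts t ≤ t) → EDFFeasible ts
sumDbf*≤t⇒EDFFeasible {ts} bound t 0≤t = ≤-trans (sumℚ-map-mono (λ τ → dbf≤dbf* τ t) ts) (bound t 0≤t)

sumDbf*≤sumU*t : ∀ {ts} → All (λ τ → T τ ≡ D τ) ts → ∀ {t} → 0ℚ ≤ t → sumDbf* ts t ≤ sumU ts * t
sumDbf*≤sumU*t [] {t} 0≤t = ≤-reflexive (sym (*-zeroˡ t))
sumDbf*≤sumU*t {τ ∷ ts} (T≡D ∷ implicit) {t} 0≤t =
  subst (sumDbf* (τ ∷ ts) t ≤_) (sym (*-distribʳ-+ t (u τ) (sumU ts)))
    (+-mono-≤ (dbf*≤u*t τ T≡D 0≤t) (sumDbf*≤sumU*t {ts} implicit {t} 0≤t))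

implicitDeadline⇒EDFFeasible : ∀ {ts} → All (λ τ → T τ ≡ D τ) ts → sumU ts ≤ 1ℚ → EDFFeasible ts
implicitDeadline⇒EDFFeasible {ts} implicit U≤1 = sumDbf*≤t⇒EDFFeasible {ts} λ t 0≤t →
  ≤-trans (sumDbf*≤sumU*t {ts} implicit {t} 0≤t)
    (subst (sumU ts * t ≤_) (*-identityˡ t) (*-monoʳ-≤-nonNeg t {{nonNegative 0≤t}} U≤1))

two-processors-optimal : ∀ {ts} → FeasiblePartition ts 2 → ¬ EDFFeasible ts → IsOptimalProcessors ts 2
two-processors-optimal {ts} partition infeasible = partition , optimal
  where
  optimal : ∀ m → FeasiblePartition ts m → 2 ℕ.≤ m
  optimal zero (Vec.[] , []↭ts , _) =
    contradiction (subst EDFFeasible (sym (↭-empty-inv (↭-sym []↭ts))) EDFFeasible-[]) infeasible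
  optimal (suc zero) ((P Vec.∷ Vec.[]) , P++[]↭ts , feasible) =
    contradiction (EDFFeasible-resp-↭ (↭-trans (↭-sym (++-identityʳ P)) P++[]↭ts) (feasible Fin.zero))
                  infeasible
  optimal (suc (suc m)) _ = ℕ.s≤s (ℕ.s≤s ℕ.z≤n)

-- Alternating task sequences and the best-fit run on them

module _ {A : Set} where

  alternate : (ℕ → A) → (ℕ → A) → ℕ → List A
  alternate f g zero = []
  alternate f g (suc zero) = f 0 ∷ []
  alternate f g (suc (suc r)) = f 0 ∷ g 0 ∷ alternate (f ∘ suc) (g ∘ suc) r

  length-alternate : ∀ f g r → length (alternate f g r) ≡ r
  length-alternate f g zero = refl
  length-alternate f g (suc zero) = refl
  length-alternate f g (suc (suc r)) = cong (suc ∘ suc) (length-alternate (f ∘ suc) (g ∘ suc) r)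

  alternate-cong : ∀ {f f′ g g′} → (∀ i → f i ≡ f′ i) → (∀ i → g i ≡ g′ i) →
                   ∀ r → alternate f g r ≡ alternate f′ g′ r
  alternate-cong f≗f′ g≗g′ zero = refl
  alternate-cong f≗f′ g≗g′ (suc zero) = cong (_∷ []) (f≗f′ 0)
  alternate-cong f≗f′ g≗g′ (suc (suc r)) =
    cong₂ _∷_ (f≗f′ 0) (cong₂ _∷_ (g≗g′ 0) (alternate-cong (f≗f′ ∘ suc) (g≗g′ ∘ suc) r))

  alternate-↭ : ∀ f g r → alternate f g r ↭ applyUpTo f ⌈ r /2⌉ ++ applyUpTo g ⌊ r /2⌋
  alternate-↭ f g zero = Perm.refl
  alternate-↭ f g (suc zero) = Perm.refl
  alternate-↭ f g (suc (suc r)) = prep (f 0) (↭-trans (prep (g 0) (alternate-↭ (f ∘ suc) (g ∘ suc) r))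
    (↭-sym (shift (g 0) (applyUpTo (f ∘ suc) ⌈ r /2⌉) (applyUpTo (g ∘ suc) ⌊ r /2⌋))))

  alternate-linked : ∀ {_≺_ : A → A → Set} {f g} → (∀ i → f i ≺ g i) → (∀ i → g i ≺ f (suc i)) →
                     ∀ r → Linked _≺_ (alternate f g r)
  alternate-linked f≺g g≺f zero = Linked.[]
  alternate-linked f≺g g≺f (suc zero) = [-]
  alternate-linked f≺g g≺f (suc (suc zero)) = f≺g 0 Linked.∷ [-]
  alternate-linked f≺g g≺f (suc (suc (suc zero))) = f≺g 0 Linked.∷ g≺f 0 Linked.∷ [-]
  alternate-linked f≺g g≺f (suc (suc (suc (suc r)))) =
    f≺g 0 Linked.∷ g≺f 0 Linked.∷ alternate-linked (f≺g ∘ suc) (g≺f ∘ suc) (suc (suc r))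

  All-alternate : ∀ {P : A → Set} {f g} → (∀ i → P (f i)) → (∀ i → P (g i)) → ∀ r → All P (alternate f g r)
  All-alternate Pf Pg zero = []
  All-alternate Pf Pg (suc zero) = Pf 0 ∷ []
  All-alternate Pf Pg (suc (suc r)) = Pf 0 ∷ Pg 0 ∷ All-alternate (Pf ∘ suc) (Pg ∘ suc) r

  ↭-sorted-unique : ∀ (key : A → ℚ) {xs ys} → xs ↭ ys →
                    Linked (λ a b → key a ≤ key b) xs → Linked (λ a b → key a < key b) ys → xs ≡ ys
  ↭-sorted-unique key {[]} {[]} _ _ _ = refl
  ↭-sorted-unique key {[]} {_ ∷ _} p _ _ = contradiction (↭-length p) λ ()
  ↭-sorted-unique key {_ ∷ _} {[]} p _ _ = contradiction (↭-length p) λ ()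
  ↭-sorted-unique key {x ∷ xs} {y ∷ ys} p xs-sorted ys-sorted with ∈-resp-↭ p (here refl)
  ... | here refl = cong (x ∷_) (↭-sorted-unique key (drop-∷ p) (Linked.tail xs-sorted) (Linked.tail ys-sorted))
  ... | there x∈ys = contradiction y<x (≤⇒≯ (x≤ (∈-resp-↭ (↭-sym p) (here refl))))
    where
    y<x : key y < key x
    y<x = All.lookup (AllPairs.head (Linked⇒AllPairs <-trans ys-sorted)) x∈ys
    x≤ : ∀ {z} → z ∈ x ∷ xs → key x ≤ key z
    x≤ (here refl) = ≤-refl
    x≤ (there z∈xs) = All.lookup (AllPairs.head (Linked⇒AllPairs ≤-trans xs-sorted)) z∈xs

n≤2*⌈n/2⌉ : ∀ n → n ℕ.≤ 2 ℕ.* ⌈ n /2⌉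
n≤2*⌈n/2⌉ n = subst₂ ℕ._≤_ (ℕ.⌊n/2⌋+⌈n/2⌉≡n n) (cong (⌈ n /2⌉ ℕ.+_) (sym (ℕ.+-identityʳ ⌈ n /2⌉)))
  (ℕ.+-monoˡ-≤ ⌈ n /2⌉ (ℕ.⌊n/2⌋≤⌈n/2⌉ n))

fromℕ-or-inject₁ : ∀ {m} (k : Fin (suc m)) → k ≡ Fin.fromℕ m ⊎ ∃[ k′ ] k ≡ inject₁ k′
fromℕ-or-inject₁ {zero} Fin.zero = inj₁ refl
fromℕ-or-inject₁ {suc m} Fin.zero = inj₂ (Fin.zero , refl)
fromℕ-or-inject₁ {suc m} (Fin.suc k) with fromℕ-or-inject₁ k
... | inj₁ refl = inj₁ refl
... | inj₂ (k′ , refl) = inj₂ (Fin.suc k′ , refl)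

module _ {A : Set} where

  lookup-∷ʳ-fromℕ : ∀ {m} (xs : Vec A m) y → lookup (xs ∷ʳ y) (Fin.fromℕ m) ≡ y
  lookup-∷ʳ-fromℕ Vec.[] y = refl
  lookup-∷ʳ-fromℕ (x Vec.∷ xs) y = lookup-∷ʳ-fromℕ xs y

  lookup-∷ʳ-inject₁ : ∀ {m} (xs : Vec A m) y k → lookup (xs ∷ʳ y) (inject₁ k) ≡ lookup xs k
  lookup-∷ʳ-inject₁ (x Vec.∷ xs) y Fin.zero = refl
  lookup-∷ʳ-inject₁ (x Vec.∷ xs) y (Fin.suc k) = lookup-∷ʳ-inject₁ xs y k

  updateAt-∷ʳ-fromℕ : ∀ {m} (xs : Vec A m) y f → updateAt (xs ∷ʳ y) (Fin.fromℕ m) f ≡ xs ∷ʳ f y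
  updateAt-∷ʳ-fromℕ Vec.[] y f = refl
  updateAt-∷ʳ-fromℕ (x Vec.∷ xs) y f = cong (x Vec.∷_) (updateAt-∷ʳ-fromℕ xs y f)

BestFitRun-≤ : ∀ {m M ts} {Ps : Vec (List Task) m} {Qs : Vec (List Task) M} → BestFitRun Ps ts M Qs → m ℕ.≤ M
BestFitRun-≤ done = ℕ.≤-refl
BestFitRun-≤ (step (assign _ _ _) rest) = BestFitRun-≤ rest
BestFitRun-≤ {m} (step (open-new _) rest) = ℕ.≤-trans (ℕ.n≤1+n m) (BestFitRun-≤ rest)

module _ {m M} {τ : Task} {ts : List Task} {Ps : Vec (List Task) m} {Qs : Vec (List Task) M} where

  rejected⇒opens-new : (∀ j → ¬ Admissible τ (lookup Ps j)) →
                       BestFitRun Ps (τ ∷ ts) M Qs → BestFitRun (Ps ∷ʳ (τ ∷ [])) ts M Qs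
  rejected⇒opens-new rejected (step (assign k admissible _) _) = contradiction admissible (rejected k)
  rejected⇒opens-new _ (step (open-new _) rest) = rest

  best⇒joins-last : ∀ {P} → Admissible τ P → (∀ j → sumDbf* (lookup Ps j) (D τ) < sumDbf* P (D τ)) →
                    BestFitRun (Ps ∷ʳ P) (τ ∷ ts) M Qs → BestFitRun (Ps ∷ʳ (τ ∷ P)) ts M Qs
  best⇒joins-last {P} admissible better (step (open-new rejected) _) =
    contradiction (subst (Admissible τ) (sym (lookup-∷ʳ-fromℕ Ps P)) admissible) (rejected (Fin.fromℕ m))
  best⇒joins-last {P} admissible better (step (assign k _ maximal) rest) with fromℕ-or-inject₁ k
  ... | inj₁ refl = subst (λ Ps′ → BestFitRun Ps′ ts M Qs) (updateAt-∷ʳ-fromℕ Ps P (τ ∷_)) rest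
  ... | inj₂ (k′ , refl) = ⊥-elim (<-irrefl refl (<-≤-trans (better k′) P≤k′))
    where
    P≤k′ : sumDbf* P (D τ) ≤ sumDbf* (lookup Ps k′) (D τ)
    P≤k′ = subst₂ (λ X Y → sumDbf* X (D τ) ≤ sumDbf* Y (D τ))
             (lookup-∷ʳ-fromℕ Ps P) (lookup-∷ʳ-inject₁ Ps P k′)
             (maximal (Fin.fromℕ m) (subst (Admissible τ) (sym (lookup-∷ʳ-fromℕ Ps P)) admissible))

module BestFitOnAlternatingTasks (a b : ℕ → Task)
  (a-rejected : ∀ {i j} → j ℕ.< i → ¬ Admissible (a i) (b j ∷ a j ∷ []))
  (b-admitted : ∀ i → Admissible (b i) (a i ∷ []))
  (b-prefers-a : ∀ {i j} → j ℕ.< i → sumDbf* (b j ∷ a j ∷ []) (D (b i)) < sumDbf* (a i ∷ []) (D (b i)))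
  where

  -- The processors after a₀ b₀ … aᵢ₋₁ bᵢ₋₁ have been assigned: the j-th one holds bⱼ and aⱼ.
  pairs : ∀ i → Vec (List Task) i
  pairs zero = Vec.[]
  pairs (suc i) = pairs i ∷ʳ (b i ∷ a i ∷ [])

  lookup-pairs : ∀ i (k : Fin i) → lookup (pairs i) k ≡ b (toℕ k) ∷ a (toℕ k) ∷ []
  lookup-pairs (suc i) k with fromℕ-or-inject₁ k
  ... | inj₁ refl = trans (lookup-∷ʳ-fromℕ (pairs i) _) (cong (λ j → b j ∷ a j ∷ []) (sym (Finₚ.toℕ-fromℕ i)))
  ... | inj₂ (k′ , refl) = trans (lookup-∷ʳ-inject₁ (pairs i) _ k′)
         (trans (lookup-pairs i k′) (cong (λ j → b j ∷ a j ∷ []) (sym (Finₚ.toℕ-inject₁ k′))))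

  module _ {M} {ts : List Task} {Qs : Vec (List Task) M} where

    a-opens-new : ∀ i → BestFitRun (pairs i) (a i ∷ ts) M Qs → BestFitRun (pairs i ∷ʳ (a i ∷ [])) ts M Qs
    a-opens-new i = rejected⇒opens-new λ k →
      subst (¬_ ∘ Admissible (a i)) (sym (lookup-pairs i k)) (a-rejected (Finₚ.toℕ<n k))

    b-joins-a : ∀ i → BestFitRun (pairs i ∷ʳ (a i ∷ [])) (b i ∷ ts) M Qs → BestFitRun (pairs (suc i)) ts M Qs
    b-joins-a i = best⇒joins-last (b-admitted i) λ k →
      subst (λ P → sumDbf* P (D (b i)) < _) (sym (lookup-pairs i k)) (b-prefers-a (Finₚ.toℕ<n k))

  processors-after : ∀ i r {M} {Qs : Vec (List Task) M} →
                     BestFitRun (pairs i) (alternate (λ x → a (x ℕ.+ i)) (λ x → b (x ℕ.+ i)) r) M Qs →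
                     ⌈ r /2⌉ ℕ.+ i ℕ.≤ M
  processors-after i zero rest = BestFitRun-≤ rest
  processors-after i (suc zero) rest = BestFitRun-≤ (a-opens-new i rest)
  processors-after i (suc (suc r)) {M} rest =
    subst (ℕ._≤ M) (ℕ.+-suc ⌈ r /2⌉ i)
      (processors-after (suc i) r (subst (λ ts → BestFitRun (pairs (suc i)) ts M _) shift-index
        (b-joins-a i (a-opens-new i rest))))
    where
    shift-index : alternate (λ x → a (suc x ℕ.+ i)) (λ x → b (suc x ℕ.+ i)) r
                ≡ alternate (λ x → a (x ℕ.+ suc i)) (λ x → b (x ℕ.+ suc i)) r
    shift-index = alternate-cong (λ x → cong a (sym (ℕ.+-suc x i))) (λ x → cong b (sym (ℕ.+-suc x i))) r

  DMBestFit-alternate : ∀ r {M} → DMBestFit (alternate a b r) M → ⌈ r /2⌉ ℕ.≤ M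
  DMBestFit-alternate zero empty = ℕ.z≤n
  DMBestFit-alternate (suc zero) (run rest) = BestFitRun-≤ rest
  DMBestFit-alternate (suc (suc r)) {M} (run rest) =
    subst (ℕ._≤ M) (ℕ.+-comm ⌈ r /2⌉ 1)
      (processors-after 1 r (subst (λ ts → BestFitRun (pairs 1) ts M _) shift-index (b-joins-a 0 rest)))
    where
    shift-index : alternate (a ∘ suc) (b ∘ suc) r ≡ alternate (λ x → a (x ℕ.+ 1)) (λ x → b (x ℕ.+ 1)) r
    shift-index = alternate-cong (λ x → cong a (ℕ.+-comm 1 x)) (λ x → cong b (ℕ.+-comm 1 x)) r

-- The task set

module Construction (N : ℕ) (8≤N : 8 ℕ.≤ N) where

  -- e = 1/N is the utilization of every b-task; the choice R = 4N gives e·R = 4, so that bⱼ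
  -- alone demands 4Rⁱ by the deadline R·Rⁱ of aᵢ.
  n : ℚ
  n = fromℕ N

  0<n : 0ℚ < n
  0<n = <-≤-trans (positive⁻¹ (fromℕ 8)) (fromℕ-mono-≤ 8≤N)

  instance
    n≢0 : NonZero n
    n≢0 = pos⇒nonZero n {{positive 0<n}}

  e : ℚ
  e = 1/ n

  0<e : 0ℚ < e
  0<e = positive⁻¹ e {{1/pos⇒pos n {{positive 0<n}}}}

  k≤N⇒k*e≤1 : ∀ {k} → k ℕ.≤ N → fromℕ k * e ≤ 1ℚ
  k≤N⇒k*e≤1 {k} k≤N = subst (fromℕ k * e ≤_) (*-inverseʳ n)
    (*-monoʳ-≤-nonNeg e {{nonNegative (<⇒≤ 0<e)}} (fromℕ-mono-≤ k≤N))

  e≤1 : e ≤ 1ℚ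
  e≤1 = subst (_≤ 1ℚ) (*-identityˡ e) (k≤N⇒k*e≤1 (ℕ.≤-trans (ℕ.m≤m+n 1 7) 8≤N))

  e+e≤1 : e + e ≤ 1ℚ
  e+e≤1 = subst (_≤ 1ℚ) (solve 1 (λ e → con (fromℕ 2) :* e := e :+ e) refl e)
            (k≤N⇒k*e≤1 (ℕ.≤-trans (ℕ.m≤m+n 2 6) 8≤N))

  R : ℚ
  R = fromℕ 4 * n

  e*R≡4 : e * R ≡ fromℕ 4
  e*R≡4 = trans (solve 3 (λ e n f → e :* (f :* n) := f :* (e :* n)) refl e n (fromℕ 4))
                (trans (cong (fromℕ 4 *_) (*-inverseˡ n)) (*-identityʳ (fromℕ 4)))

  32≤R : fromℕ 32 ≤ R
  32≤R = *-monoˡ-≤-nonNeg (fromℕ 4) (fromℕ-mono-≤ 8≤N)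

  -- For a numeral k the instance argument is discharged by evaluation.
  0<R-k : ∀ k → .{{Positive (fromℕ 32 - k)}} → 0ℚ < R - k
  0<R-k k = subst (0ℚ <_)
    (solve 2 (λ r k → (r :- con (fromℕ 32)) :+ (con (fromℕ 32) :- k) := r :- k) refl R k)
    (+-mono-≤-< (p≤q⇒0≤q-p 32≤R) (positive⁻¹ (fromℕ 32 - k)))

  0<R : 0ℚ < R
  0<R = <-≤-trans (positive⁻¹ (fromℕ 32)) 32≤R

  x≤R*x : ∀ {x} → 0ℚ ≤ x → x ≤ R * x
  x≤R*x {x} 0≤x = ≤-by ((R - 1ℚ) * x) (solve 2 (λ r x → r :* x := x :+ (r :- con 1ℚ) :* x) refl R x)
    (*-nonNeg (<⇒≤ (0<R-k 1ℚ)) 0≤x)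

  R^_ : ℕ → ℚ
  R^ zero = 1ℚ
  R^ (suc k) = R * R^ k

  0<R^ : ∀ k → 0ℚ < R^ k
  0<R^ zero = positive⁻¹ 1ℚ
  0<R^ (suc k) = *-pos 0<R (0<R^ k)

  R*R^j≤R^i : ∀ {j i} → j ℕ.< i → R * R^ j ≤ R^ i
  R*R^j≤R^i {j} {suc i} (ℕ.s≤s j≤i) with ℕ.m≤n⇒m<n∨m≡n j≤i
  ... | inj₂ refl = ≤-refl
  ... | inj₁ j<i = ≤-trans (R*R^j≤R^i j<i) (x≤R*x (<⇒≤ (0<R^ i)))

  C-a : ℕ → ℚ
  C-a k = (R - fromℕ 2) * R^ k

  0<C-a : ∀ k → 0ℚ < C-a k
  0<C-a k = *-pos (0<R-k (fromℕ 2)) (0<R^ k)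

  aT : ℕ → Task
  aT k = task (C-a k) (C-a k * (n * R)) (R * R^ k)
    (positive (0<C-a k)) (positive (*-pos (0<C-a k) (*-pos 0<n 0<R))) (positive (*-pos 0<R (0<R^ k)))

  bT : ℕ → Task
  bT k = task (e * (fromℕ 2 * (R * R^ k))) (fromℕ 2 * (R * R^ k)) (fromℕ 2 * (R * R^ k))
    (positive (*-pos 0<e 0<2RP)) (positive 0<2RP) (positive 0<2RP)
    where
    0<2RP : 0ℚ < fromℕ 2 * (R * R^ k)
    0<2RP = *-pos (positive⁻¹ (fromℕ 2)) (*-pos 0<R (0<R^ k))

  u-b : ∀ k → u (bT k) ≡ e
  u-b k = trans (solve 3 (λ e d w → e :* d :* w := e :* (d :* w)) refl e (D (bT k)) (1/T (bT k)))
                (trans (cong (e *_) (T*1/T≡1 (bT k))) (*-identityʳ e))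

  R*u-a : ∀ k → R * u (aT k) ≡ e
  R*u-a k = begin
    R * u (aT k)              ≡⟨ sym (*-identityʳ _) ⟩
    R * u (aT k) * 1ℚ         ≡⟨ cong (R * u (aT k) *_) (sym (*-inverseˡ n)) ⟩
    R * u (aT k) * (e * n)    ≡⟨ solve 4 (λ r u e n → r :* u :* (e :* n) := e :* (u :* (n :* r)))
                                         refl R (u (aT k)) e n ⟩
    e * (u (aT k) * (n * R))  ≡⟨ cong (e *_) u*nR≡1 ⟩
    e * 1ℚ                    ≡⟨ *-identityʳ e ⟩
    e                         ∎
    where
    open ≡-Reasoning
    u*nR≡1 : u (aT k) * (n * R) ≡ 1ℚ
    u*nR≡1 = trans (solve 4 (λ c w n r → c :* w :* (n :* r) := c :* (n :* r) :* w) refl (C-a k) (1/T (aT k)) n R)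
                   (T*1/T≡1 (aT k))

  u-a≤e : ∀ k → u (aT k) ≤ e
  u-a≤e k = subst (u (aT k) ≤_) (R*u-a k) (x≤R*x (0≤u (aT k)))

  e*[R*x]≡4*x : ∀ x → e * (R * x) ≡ fromℕ 4 * x
  e*[R*x]≡4*x x = trans (sym (*-assoc e R x)) (cong (_* x) e*R≡4)

  C-b≡8*R^ : ∀ k → C (bT k) ≡ fromℕ 8 * R^ k
  C-b≡8*R^ k = begin
    e * (fromℕ 2 * (R * R^ k))    ≡⟨ solve 4 (λ e t r p → e :* (t :* (r :* p)) := t :* (e :* (r :* p)))
                                             refl e (fromℕ 2) R (R^ k) ⟩
    fromℕ 2 * (e * (R * R^ k))    ≡⟨ cong (fromℕ 2 *_) (e*[R*x]≡4*x (R^ k)) ⟩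
    fromℕ 2 * (fromℕ 4 * R^ k)    ≡⟨ sym (*-assoc (fromℕ 2) (fromℕ 4) (R^ k)) ⟩
    fromℕ 8 * R^ k                ∎
    where open ≡-Reasoning

  D-a<D-b : ∀ k → D (aT k) < D (bT k)
  D-a<D-b k = <-by (R * R^ k) (solve 1 (λ x → con (fromℕ 2) :* x := x :+ x) refl (R * R^ k)) (*-pos 0<R (0<R^ k))

  D-b<D-a : ∀ k → D (bT k) < D (aT (suc k))
  D-b<D-a k = <-by ((R - fromℕ 2) * (R * R^ k))
    (solve 2 (λ r x → r :* x := con (fromℕ 2) :* x :+ (r :- con (fromℕ 2)) :* x) refl R (R * R^ k))
    (*-pos (0<R-k (fromℕ 2)) (*-pos 0<R (0<R^ k)))

  D-b≤D-a : ∀ {j i} → j ℕ.< i → D (bT j) ≤ D (aT i)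
  D-b≤D-a {j} j<i = ≤-trans (<⇒≤ (D-b<D-a j)) (*-monoˡ-≤-nonNeg R {{nonNegative (<⇒≤ 0<R)}} (R*R^j≤R^i j<i))

  dbf*-b : ∀ k {t} → D (bT k) ≤ t → dbf* (bT k) t ≡ e * t
  dbf*-b k {t} D≤t = trans (dbf*-implicitDeadline (bT k) refl D≤t) (cong (_* t) (u-b k))

  dbf*-a-at-D-b : ∀ k → dbf* (aT k) (D (bT k)) ≡ C-a k + R^ k * e
  dbf*-a-at-D-b k = trans (dbf*-above-u (aT k) (<⇒≤ (D-a<D-b k)))
    (cong (C-a k +_) (trans (solve 3 (λ r p u → (con (fromℕ 2) :* (r :* p) :- r :* p) :* u := p :* (r :* u))
                                     refl R (R^ k) (u (aT k)))
                            (cong (R^ k *_) (R*u-a k))))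

  C-a≤R*R^ : ∀ k → C-a k ≤ R * R^ k
  C-a≤R*R^ k = ≤-by (fromℕ 2 * R^ k)
    (solve 2 (λ r p → r :* p := (r :- con (fromℕ 2)) :* p :+ con (fromℕ 2) :* p) refl R (R^ k))
    (*-nonNeg (<⇒≤ (positive⁻¹ (fromℕ 2))) (<⇒≤ (0<R^ k)))

  a-rejected : ∀ {i j} → j ℕ.< i → ¬ Admissible (aT i) (bT j ∷ aT j ∷ [])
  a-rejected {i} {j} j<i (demand≤D , _) = ≤⇒≯ demand≤D D<demand
    where
    X : ℚ
    X = dbf* (aT j) (R * R^ i)
    D<demand : R * R^ i < C-a i + (dbf* (bT j) (R * R^ i) + (X + 0ℚ))
    D<demand = subst (λ y → R * R^ i < C-a i + (y + (X + 0ℚ)))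
      (sym (trans (dbf*-b j (D-b≤D-a j<i)) (e*[R*x]≡4*x (R^ i))))
      (<-by (fromℕ 2 * R^ i + X)
        (solve 3 (λ r p x → (r :- con (fromℕ 2)) :* p :+ (con (fromℕ 4) :* p :+ (x :+ con 0ℚ))
                            := r :* p :+ (con (fromℕ 2) :* p :+ x)) refl R (R^ i) X)
        (+-mono-<-≤ (*-pos (positive⁻¹ (fromℕ 2)) (0<R^ i)) (0≤dbf* (aT j) (R * R^ i))))

  b-admitted : ∀ i → Admissible (bT i) (aT i ∷ [])
  b-admitted i = demand≤D , utilization≤1
    where
    demand≤D : C (bT i) + (dbf* (aT i) (D (bT i)) + 0ℚ) ≤ D (bT i)
    demand≤D = subst (_≤ D (bT i)) (sym (cong₂ (λ c d → c + (d + 0ℚ)) (C-b≡8*R^ i) (dbf*-a-at-D-b i)))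
      (≤-by (R^ i * ((R - fromℕ 7) + (1ℚ - e)))
        (solve 3 (λ r p e → con (fromℕ 2) :* (r :* p)
                            := con (fromℕ 8) :* p :+ ((r :- con (fromℕ 2)) :* p :+ p :* e :+ con 0ℚ)
                               :+ p :* ((r :- con (fromℕ 7)) :+ (con 1ℚ :- e))) refl R (R^ i) e)
        (*-nonNeg (<⇒≤ (0<R^ i)) (+-mono-≤ (<⇒≤ (0<R-k (fromℕ 7))) (p≤q⇒0≤q-p e≤1))))
    utilization≤1 : u (bT i) + (u (aT i) + 0ℚ) ≤ 1ℚ
    utilization≤1 = subst (λ x → x + (u (aT i) + 0ℚ) ≤ 1ℚ) (sym (u-b i))
      (≤-trans (+-monoʳ-≤ e (+-monoˡ-≤ 0ℚ (u-a≤e i))) (subst (_≤ 1ℚ) (cong (e +_) (sym (+-identityʳ e))) e+e≤1))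

  b-prefers-a : ∀ {i j} → j ℕ.< i → sumDbf* (bT j ∷ aT j ∷ []) (D (bT i)) < sumDbf* (aT i ∷ []) (D (bT i))
  b-prefers-a {i} {j} j<i = begin-strict
    dbf* (bT j) t + (dbf* (aT j) t + 0ℚ)
      ≡⟨ cong (_+ (dbf* (aT j) t + 0ℚ)) (trans (dbf*-b j D-b≤t) (C-b≡8*R^ i)) ⟩
    fromℕ 8 * R^ i + (dbf* (aT j) t + 0ℚ)
      ≤⟨ +-monoʳ-≤ (fromℕ 8 * R^ i) (+-monoˡ-≤ 0ℚ (dbf*≤C+t*u (aT j) 0≤t)) ⟩
    fromℕ 8 * R^ i + (C-a j + t * u (aT j) + 0ℚ)
      ≡⟨ cong (λ y → fromℕ 8 * R^ i + (C-a j + y + 0ℚ)) t*u-a≡2R^e ⟩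
    fromℕ 8 * R^ i + (C-a j + fromℕ 2 * R^ i * e + 0ℚ)
      ≤⟨ +-monoʳ-≤ (fromℕ 8 * R^ i) (+-monoˡ-≤ 0ℚ (+-monoˡ-≤ (fromℕ 2 * R^ i * e) C-a≤R^i)) ⟩
    fromℕ 8 * R^ i + (R^ i + fromℕ 2 * R^ i * e + 0ℚ)
      <⟨ <-by (R^ i * (R - fromℕ 12) + R^ i * (1ℚ - e)) slack-eq
              (+-mono-<-≤ (*-pos (0<R^ i) (0<R-k (fromℕ 12))) (*-nonNeg (<⇒≤ (0<R^ i)) (p≤q⇒0≤q-p e≤1))) ⟩
    C-a i + R^ i * e + 0ℚ
      ≡⟨ cong (_+ 0ℚ) (sym (dbf*-a-at-D-b i)) ⟩
    dbf* (aT i) t + 0ℚ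
      ∎
    where
    open ≤-Reasoning
    t : ℚ
    t = D (bT i)
    0≤t : 0ℚ ≤ t
    0≤t = <⇒≤ (0<D (bT i))
    D-b≤t : D (bT j) ≤ t
    D-b≤t = ≤-trans (D-b≤D-a j<i) (<⇒≤ (D-a<D-b i))
    t*u-a≡2R^e : t * u (aT j) ≡ fromℕ 2 * R^ i * e
    t*u-a≡2R^e = trans
      (solve 4 (λ r p u t → t :* (r :* p) :* u := t :* p :* (r :* u)) refl R (R^ i) (u (aT j)) (fromℕ 2))
      (cong (fromℕ 2 * R^ i *_) (R*u-a j))
    C-a≤R^i : C-a j ≤ R^ i
    C-a≤R^i = ≤-trans (C-a≤R*R^ j) (R*R^j≤R^i j<i)
    slack-eq : C-a i + R^ i * e + 0ℚ
             ≡ fromℕ 8 * R^ i + (R^ i + fromℕ 2 * R^ i * e + 0ℚ) + (R^ i * (R - fromℕ 12) + R^ i * (1ℚ - e))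
    slack-eq = solve 3 (λ r p e → (r :- con (fromℕ 2)) :* p :+ p :* e :+ con 0ℚ
                                  := con (fromℕ 8) :* p :+ (p :+ con (fromℕ 2) :* p :* e :+ con 0ℚ)
                                     :+ (p :* (r :- con (fromℕ 12)) :+ p :* (con 1ℚ :- e))) refl R (R^ i) e

  R*dbf*-a≤ : ∀ k {t} → 0ℚ ≤ t → R * dbf* (aT k) t ≤ R * C-a k + e * t
  R*dbf*-a≤ k {t} 0≤t = subst (R * dbf* (aT k) t ≤_) R*[C+tu]≡RC+et
    (*-monoˡ-≤-nonNeg R {{nonNegative (<⇒≤ 0<R)}} (dbf*≤C+t*u (aT k) 0≤t))
    where
    R*[C+tu]≡RC+et : R * (C-a k + t * u (aT k)) ≡ R * C-a k + e * t
    R*[C+tu]≡RC+et = trans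
      (solve 4 (λ r c t u → r :* (c :+ t :* u) := r :* c :+ (r :* u) :* t) refl R (C-a k) t (u (aT k)))
                           (cong (λ y → R * C-a k + y * t) (R*u-a k))

  -- Once a₀ … a_(c−1) are all active, their execution times (R − 2)Rᵏ sum to less than
  -- (1 − 1/R)·Rᶜ, and each of them adds a slope u = e/R.
  aTasks-demand-saturated : ∀ c {t} → R^ c ≤ t →
                            R * sumDbf* (applyDownFrom aT c) t ≤ (R - 1ℚ) * R^ c + fromℕ c * (e * t)
  aTasks-demand-saturated zero {t} 1≤t = subst (_≤ (R - 1ℚ) * 1ℚ + 0ℚ * (e * t)) (sym (*-zeroʳ R))
    (+-mono-≤ (*-nonNeg (<⇒≤ (0<R-k 1ℚ)) (<⇒≤ (0<R^ 0)))
              (*-nonNeg ≤-refl (*-nonNeg (<⇒≤ 0<e) (≤-trans (<⇒≤ (0<R^ 0)) 1≤t))))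
  aTasks-demand-saturated (suc c) {t} R^c≤t = begin
    R * (dbf* (aT c) t + S)
      ≡⟨ *-distribˡ-+ R (dbf* (aT c) t) S ⟩
    R * dbf* (aT c) t + R * S
      ≤⟨ +-mono-≤ (R*dbf*-a≤ c 0≤t) (aTasks-demand-saturated c (≤-trans (x≤R*x (<⇒≤ (0<R^ c))) R^c≤t)) ⟩
    R * C-a c + e * t + ((R - 1ℚ) * R^ c + fromℕ c * (e * t))
      ≤⟨ ≤-by (R^ c) slack-eq (<⇒≤ (0<R^ c)) ⟩
    (R - 1ℚ) * (R * R^ c) + fromℕ (suc c) * (e * t)
      ∎
    where
    open ≤-Reasoning
    S : ℚ
    S = sumDbf* (applyDownFrom aT c) t
    0≤t : 0ℚ ≤ t
    0≤t = ≤-trans (<⇒≤ (0<R^ (suc c))) R^c≤t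
    slack-eq : (R - 1ℚ) * (R * R^ c) + fromℕ (suc c) * (e * t)
             ≡ R * C-a c + e * t + ((R - 1ℚ) * R^ c + fromℕ c * (e * t)) + R^ c
    slack-eq = trans (cong (λ k → (R - 1ℚ) * (R * R^ c) + k * (e * t)) (fromℕ-suc c))
      (solve 4 (λ r p k x → (r :- con 1ℚ) :* (r :* p) :+ (k :+ con 1ℚ) :* x
                            := r :* ((r :- con (fromℕ 2)) :* p) :+ x :+ ((r :- con 1ℚ) :* p :+ k :* x) :+ p)
               refl R (R^ c) (fromℕ c) (e * t))

  aTasks-demand : ∀ c {t} → 0ℚ ≤ t →
                  R * sumDbf* (applyDownFrom aT c) t ≤ (R - 1ℚ) * t + fromℕ c * (e * t)
  aTasks-demand zero {t} 0≤t = subst (_≤ (R - 1ℚ) * t + 0ℚ * (e * t)) (sym (*-zeroʳ R))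
    (+-mono-≤ (*-nonNeg (<⇒≤ (0<R-k 1ℚ)) 0≤t) (*-nonNeg ≤-refl (*-nonNeg (<⇒≤ 0<e) 0≤t)))
  aTasks-demand (suc c) {t} 0≤t = [ inactive , saturated ]′ (<∨≥ t (D (aT c)))
    where
    open ≤-Reasoning
    S : ℚ
    S = sumDbf* (applyDownFrom aT c) t
    inactive : t < D (aT c) → R * (dbf* (aT c) t + S) ≤ (R - 1ℚ) * t + fromℕ (suc c) * (e * t)
    inactive t<D = begin
      R * (dbf* (aT c) t + S)                      ≡⟨ cong (λ d → R * (d + S)) (dbf*-below (aT c) t<D) ⟩
      R * (0ℚ + S)                                 ≡⟨ cong (R *_) (+-identityˡ S) ⟩
      R * S                                        ≤⟨ aTasks-demand c 0≤t ⟩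
      (R - 1ℚ) * t + fromℕ c * (e * t)             ≤⟨ ≤-by (e * t) slack-eq (*-nonNeg (<⇒≤ 0<e) 0≤t) ⟩
      (R - 1ℚ) * t + fromℕ (suc c) * (e * t)       ∎
      where
      slack-eq : (R - 1ℚ) * t + fromℕ (suc c) * (e * t) ≡ (R - 1ℚ) * t + fromℕ c * (e * t) + e * t
      slack-eq = trans (cong (λ k → (R - 1ℚ) * t + k * (e * t)) (fromℕ-suc c))
        (solve 3 (λ y k x → y :+ (k :+ con 1ℚ) :* x := y :+ k :* x :+ x) refl ((R - 1ℚ) * t) (fromℕ c) (e * t))
    saturated : D (aT c) ≤ t → R * (dbf* (aT c) t + S) ≤ (R - 1ℚ) * t + fromℕ (suc c) * (e * t)
    saturated D≤t = ≤-trans (aTasks-demand-saturated (suc c) D≤t)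
      (+-monoˡ-≤ (fromℕ (suc c) * (e * t)) (*-monoˡ-≤-nonNeg (R - 1ℚ) {{nonNegative (<⇒≤ (0<R-k 1ℚ))}} D≤t))

  k*[e*t]≤t : ∀ {k t} → k ℕ.≤ N → 0ℚ ≤ t → fromℕ k * (e * t) ≤ t
  k*[e*t]≤t {k} {t} k≤N 0≤t = subst₂ _≤_ (*-assoc (fromℕ k) e t) (*-identityˡ t)
    (*-monoʳ-≤-nonNeg t {{nonNegative 0≤t}} (k≤N⇒k*e≤1 k≤N))

  aTasks-feasible : ∀ {c} → c ℕ.≤ N → EDFFeasible (applyUpTo aT c)
  aTasks-feasible {c} c≤N =
    EDFFeasible-resp-↭ (subst (_↭ applyUpTo aT c) (List.reverse-applyUpTo aT c) (↭-reverse _))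
    (sumDbf*≤t⇒EDFFeasible {applyDownFrom aT c} λ t 0≤t → *-cancelˡ-≤-pos R {{positive 0<R}} (begin
      R * sumDbf* (applyDownFrom aT c) t        ≤⟨ aTasks-demand c 0≤t ⟩
      (R - 1ℚ) * t + fromℕ c * (e * t)          ≤⟨ +-monoʳ-≤ ((R - 1ℚ) * t) (k*[e*t]≤t c≤N 0≤t) ⟩
      (R - 1ℚ) * t + t                          ≡⟨ solve 2 (λ r t → (r :- con 1ℚ) :* t :+ t := r :* t) refl R t ⟩
      R * t                                     ∎))
    where open ≤-Reasoning

  bTasks-feasible : ∀ {c} → c ℕ.≤ N → EDFFeasible (applyUpTo bT c)
  bTasks-feasible {c} c≤N = implicitDeadline⇒EDFFeasible (applyUpTo⁺₂ bT c (λ _ → refl))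
    (subst (_≤ 1ℚ) (sym (sumU-applyUpTo u-b c)) (k≤N⇒k*e≤1 c≤N))

  -- At t = R², b₀ and a₁ alone demand 4(R − 2) + (R − 2)R > R².
  alternate-infeasible : ∀ r → ¬ EDFFeasible (alternate aT bT (4 ℕ.+ r))
  alternate-infeasible r feasible = ≤⇒≯ (feasible t (<⇒≤ (0<D (aT 1)))) t<demand
    where
    open ≤-Reasoning
    t : ℚ
    t = D (aT 1)
    f : Task → ℚ
    f τ = dbf τ t
    rest : List Task
    rest = alternate (aT ∘ suc ∘ suc) (bT ∘ suc ∘ suc) r
    S : ℚ
    S = sumℚ (map f rest)
    b₀-demand : (R - fromℕ 2) * fromℕ 4 ≤ f (bT 0)
    b₀-demand = subst (_≤ f (bT 0)) [t-D]*u≡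
      ([t-D]*u≤dbf (bT 0) (<⇒≤ (D-b<D-a 0)))
      where
      [t-D]*u≡ : (t - D (bT 0)) * u (bT 0) ≡ (R - fromℕ 2) * fromℕ 4
      [t-D]*u≡ = trans (cong ((t - D (bT 0)) *_) (u-b 0))
        (trans (solve 2 (λ r e → (r :* (r :* con 1ℚ) :- con (fromℕ 2) :* (r :* con 1ℚ)) :* e
                                 := (r :- con (fromℕ 2)) :* (e :* r)) refl R e)
               (cong ((R - fromℕ 2) *_) e*R≡4))
    t<demand : t < f (aT 0) + (f (bT 0) + (f (aT 1) + (f (bT 1) + S)))
    t<demand = begin-strict
      t
        <⟨ <-by (fromℕ 2 * (R - fromℕ 4)) square-eq (*-pos (positive⁻¹ (fromℕ 2)) (0<R-k (fromℕ 4))) ⟩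
      (R - fromℕ 2) * fromℕ 4 + C-a 1
        ≤⟨ +-mono-≤ b₀-demand (C≤dbf (aT 1) ≤-refl) ⟩
      f (bT 0) + f (aT 1)
        ≤⟨ ≤-by (f (aT 0) + (f (bT 1) + S)) regroup
                (+-mono-≤ (0≤dbf (aT 0) t) (+-mono-≤ (0≤dbf (bT 1) t) (sumℚ-map-nonNeg (λ τ → 0≤dbf τ t) rest))) ⟩
      f (aT 0) + (f (bT 0) + (f (aT 1) + (f (bT 1) + S)))
        ∎
      where
      square-eq : (R - fromℕ 2) * fromℕ 4 + C-a 1 ≡ t + fromℕ 2 * (R - fromℕ 4)
      square-eq = solve 1 (λ r → (r :- con (fromℕ 2)) :* con (fromℕ 4) :+ (r :- con (fromℕ 2)) :* (r :* con 1ℚ)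
                                 := r :* (r :* con 1ℚ) :+ con (fromℕ 2) :* (r :- con (fromℕ 4))) refl R
      regroup : f (aT 0) + (f (bT 0) + (f (aT 1) + (f (bT 1) + S)))
              ≡ f (bT 0) + f (aT 1) + (f (aT 0) + (f (bT 1) + S))
      regroup = solve 5 (λ a₀ b₀ a₁ b₁ s → a₀ :+ (b₀ :+ (a₁ :+ (b₁ :+ s))) := b₀ :+ a₁ :+ (a₀ :+ (b₁ :+ s)))
                  refl (f (aT 0)) (f (bT 0)) (f (aT 1)) (f (bT 1)) S

  tasks : List Task
  tasks = alternate aT bT N

  tasks-infeasible : ¬ EDFFeasible tasks
  tasks-infeasible = subst (¬_ ∘ EDFFeasible ∘ alternate aT bT) (ℕ.m+[n∸m]≡n (ℕ.≤-trans (ℕ.m≤m+n 4 4) 8≤N))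
    (alternate-infeasible (N ∸ 4))

  tasks-partition : FeasiblePartition tasks 2
  tasks-partition = (applyUpTo aT ⌈ N /2⌉ Vec.∷ applyUpTo bT ⌊ N /2⌋ Vec.∷ Vec.[])
    , subst (_↭ tasks) (cong (applyUpTo aT ⌈ N /2⌉ ++_) (sym (List.++-identityʳ (applyUpTo bT ⌊ N /2⌋))))
        (↭-sym (alternate-↭ aT bT N))
    , λ { Fin.zero → aTasks-feasible (ℕ.⌈n/2⌉≤n N) ; (Fin.suc Fin.zero) → bTasks-feasible (ℕ.⌊n/2⌋≤n N) }

  C≤D-b : ∀ k → C (bT k) ≤ D (bT k)
  C≤D-b k = ≤-by ((1ℚ - e) * D (bT k))
    (solve 2 (λ e d → d := e :* d :+ (con 1ℚ :- e) :* d) refl e (D (bT k)))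
                 (*-nonNeg (p≤q⇒0≤q-p e≤1) (<⇒≤ (0<D (bT k))))

  1≤n*R : 1ℚ ≤ n * R
  1≤n*R = ≤-trans (fromℕ-mono-≤ (ℕ.≤-trans (ℕ.m≤m+n 1 7) 8≤N)) (subst (n ≤_) (*-comm R n) (x≤R*x (<⇒≤ 0<n)))

  C≤T-a : ∀ k → C (aT k) ≤ T (aT k)
  C≤T-a k = ≤-by (C-a k * (n * R - 1ℚ))
    (solve 3 (λ c n r → c :* (n :* r) := c :+ c :* (n :* r :- con 1ℚ)) refl (C-a k) n R)
                 (*-nonNeg (<⇒≤ (0<C-a k)) (p≤q⇒0≤q-p 1≤n*R))

  tasks-assumptions : All Assumptions tasks
  tasks-assumptions =
    All-alternate {P = Assumptions} {aT} {bT} (λ k → C≤T-a k , C-a≤R*R^ k) (λ k → C≤D-b k , C≤D-b k) N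

  tasks-sorted : Linked (λ a b → D a < D b) tasks
  tasks-sorted = alternate-linked D-a<D-b D-b<D-a N

  DMBestFit-processors : ∀ ts → ts ↭ tasks → DMSorted ts → ∀ M → DMBestFit ts M → ⌈ N /2⌉ ℕ.≤ M
  DMBestFit-processors ts ts↭tasks sorted M dm =
    BestFitOnAlternatingTasks.DMBestFit-alternate aT bT a-rejected b-admitted b-prefers-a N
      (subst (λ ts → DMBestFit ts M) (↭-sorted-unique D ts↭tasks sorted tasks-sorted) dm)

  DMBestFit-ratio : ∀ ts → ts ↭ tasks → DMSorted ts → ∀ M → DMBestFit ts M → N ℕ.* 2 ℕ.≤ 4 ℕ.* M
  DMBestFit-ratio ts ts↭tasks sorted M dm =
    ℕ.≤-trans (ℕ.*-monoˡ-≤ 2 N≤2M) (ℕ.≤-reflexive (trans (ℕ.*-comm (2 ℕ.* M) 2) (sym (ℕ.*-assoc 2 2 M))))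
    where
    N≤2M : N ℕ.≤ 2 ℕ.* M
    N≤2M = ℕ.≤-trans (n≤2*⌈n/2⌉ N) (ℕ.*-monoʳ-≤ 2 (DMBestFit-processors ts ts↭tasks sorted M dm))

mainTheorem2 : ∀ (N : ℕ) → 8 ℕ.≤ N →
    Σ (List Task) λ ts → (length ts ≡ N) × All Assumptions ts ×
      (∃[ M* ] (IsOptimalProcessors ts M* ×
        (∀ (ts' : List Task) → ts' ↭ ts → DMSorted ts' →
          ∀ (M : ℕ) → DMBestFit ts' M → N ℕ.* M* ℕ.≤ 4 ℕ.* M)))
mainTheorem2 N 8≤N =
  tasks , length-alternate aT bT N , tasks-assumptions ,
  2 , two-processors-optimal tasks-partition tasks-infeasible , DMBestFit-ratio
  where open Construction N 8≤N
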